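{- Let $G$ be a connected block graph with at least one cut-vertex and let $T$ be its block-cutpoint graph. Then $i_I(G)=i_I^{*}(T)$.
   Context: A function $f:V(G)\to\{0,1,2\}$ is an Italian dominating function if every vertex $v$ with $f(v)=0$ satisfies $\sum_{u\in N(v)}f(u)\ge 2$; it is independent if $\{v:f(v)\neq 0\}$ is an independent set; its weight is $w(f)=\sum_v f(v)$; $i_I(G)$ is the minimum weight of an independent Italian dominating function of $G$. A block graph is a connected graph each of whose blocks (maximal subgraphs without cut-vertex) is a clique. The block-cutpoint graph $T$ of $G$ is the bipartite graph whose vertices are the cut-vertices of $G$ and one block-vertex $b$ for each block $B$ of $G$, with cut-vertex $v$ adjacent to $b$ iff $v\in B$. Given $f:V(G)\to\{0,1,2\}$, the induced function $f_*$ on $V(T)$ is defined by $f_*(v)=f(v)$ for each cut-vertex $v$ and $f_*(b)=f(B)-f(C)$ for each block $B$ with block-vertex $b$, where $C$ is the set of cut-vertices in $B$ and $f(S)=\sum_{x\in S}f(x)$. If $f$ is an independent Italian dominating function of $G$, then $f_*$ is called an induced independent Italian dominating function (IIIDF) of $T$. The weight of $f_*$ is $\sum_{x\in V(T)}f_*(x)$, and $i_I^{*}(T)$ is the minimum weight of an IIIDF of $T$. -}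

module Defs where

open import Data.Nat using (ℕ; zero; suc; _≤_)
open import Data.Integer as ℤ using (ℤ; +_)
open import Data.Bool using (Bool; true; false; if_then_else_)
open import Data.Fin using (Fin)
open import Data.Fin.Subset using (Subset; _∈_; _⊆_; ⊤; ⁅_⁆; _─_; Nonempty; inside)
open import Data.Fin.Subset.Properties using (_∈?_)
open import Data.List using (List; length; map; allFin; lookup)
open import Data.Nat.ListAction using (sum)
open import Data.List.Membership.Propositional using () renaming (_∈_ to _∈ˡ_)
open import Data.List.Relation.Unary.Unique.Propositional using (Unique)
open import Data.Product using (Σ; ∃; _×_; _,_)
open import Data.Sum using (_⊎_; inj₁; inj₂)
open import Data.Empty using (⊥)
open import Relation.Nullary using (¬_; does)
open import Relation.Binary.PropositionalEquality using (_≡_; _≢_)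
open import Function.Bundles using (_⇔_)

record Graph (n : ℕ) : Set where
  field
    adj    : Fin n → Fin n → Bool
    sym    : ∀ u v → adj u v ≡ adj v u
    irrefl : ∀ v → adj v v ≡ false

module _ {n : ℕ} (G : Graph n) where
  open Graph G

  Adj : Fin n → Fin n → Set
  Adj u v = adj u v ≡ true

  data Walk (S : Subset n) : Fin n → Fin n → Set where
    here : ∀ {v} → v ∈ S → Walk S v v
    step : ∀ {u v w} → u ∈ S → Adj u v → Walk S v w → Walk S u w

  Connected : Subset n → Set
  Connected S = ∀ u v → u ∈ S → v ∈ S → Walk S u v

  IsCutVertexOf : Subset n → Fin n → Set
  IsCutVertexOf S x =
    x ∈ S × ∃ λ u → ∃ λ v → u ∈ S × v ∈ S × u ≢ x × v ≢ x ×
      Walk S u v × ¬ Walk (S ─ ⁅ x ⁆) u v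

  IsCutVertex : Fin n → Set
  IsCutVertex x = IsCutVertexOf ⊤ x

  NonseparableSet : Subset n → Set
  NonseparableSet S = Nonempty S × Connected S × (∀ x → ¬ IsCutVertexOf S x)

  -- a block: maximal connected subgraph without cut-vertex
  -- (maximal such subgraphs are induced, so vertex sets suffice)
  IsBlock : Subset n → Set
  IsBlock S = NonseparableSet S × (∀ S′ → S ⊆ S′ → NonseparableSet S′ → S′ ⊆ S)

  IsBlockGraph : Set
  IsBlockGraph = Connected ⊤ ×
    (∀ S → IsBlock S → ∀ u v → u ∈ S → v ∈ S → u ≢ v → Adj u v)

  weightOn : (Fin n → ℕ) → Subset n → ℕ
  weightOn f S = sum (map (λ i → if does (i ∈? S) then f i else 0) (allFin n))

  weight : (Fin n → ℕ) → ℕ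
  weight f = weightOn f ⊤

  nbrSum : (Fin n → ℕ) → Fin n → ℕ
  nbrSum f v = sum (map (λ u → if adj v u then f u else 0) (allFin n))

  IsIIDF : (Fin n → ℕ) → Set
  IsIIDF f = (∀ v → f v ≤ 2)
           × (∀ v → f v ≡ 0 → 2 ≤ nbrSum f v)
           × (∀ u v → Adj u v → f u ≡ 0 ⊎ f v ≡ 0)

  -- Its data (the list of cut-vertices and
  -- the list of blocks, each without repetition) is uniquely determined by
  -- G up to ordering, via the specification fields.

  record BlockCutpointGraph : Set₁ where
    field
      cuts         : List (Fin n)
      cuts-unique  : Unique cuts
      cuts-spec    : ∀ v → (v ∈ˡ cuts) ⇔ IsCutVertex v
      blocks       : List (Subset n)
      blocks-unique : Unique blocks
      blocks-spec  : ∀ S → (S ∈ˡ blocks) ⇔ IsBlock S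

    Vertex : Set
    Vertex = Fin (length cuts) ⊎ Fin (length blocks)

    cutAt : Fin (length cuts) → Fin n
    cutAt = lookup cuts

    blockAt : Fin (length blocks) → Subset n
    blockAt = lookup blocks

    AdjT : Vertex → Vertex → Set
    AdjT (inj₁ i) (inj₂ j) = cutAt i ∈ blockAt j
    AdjT (inj₂ j) (inj₁ i) = cutAt i ∈ blockAt j
    AdjT _ _ = ⊥

    allVertices : List Vertex
    allVertices = map inj₁ (allFin (length cuts)) Data.List.++ map inj₂ (allFin (length blocks))

    cutWeightIn : (Fin n → ℕ) → Subset n → ℕ
    cutWeightIn f B = sum (map (λ v → if does (v ∈? B) then f v else 0) cuts)

    induced : (Fin n → ℕ) → Vertex → ℤ
    induced f (inj₁ i) = + f (cutAt i)
    induced f (inj₂ j) = + weightOn f (blockAt j) ℤ.- + cutWeightIn f (blockAt j)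

    IsIIIDF : (Vertex → ℤ) → Set
    IsIIIDF g = ∃ λ f → IsIIDF f × (∀ x → g x ≡ induced f x)

    weightT : (Vertex → ℤ) → ℤ
    weightT g = Data.List.foldr ℤ._+_ (+ 0) (map g allVertices)

IsMinℕ : {A : Set} → (A → Set) → (A → ℕ) → ℕ → Set
IsMinℕ P w m = (∃ λ a → P a × w a ≡ m) × (∀ a → P a → m ≤ w a)

IsMinℤ : {A : Set} → (A → Set) → (A → ℤ) → ℤ → Set
IsMinℤ P w m = (∃ λ a → P a × w a ≡ m) × (∀ a → P a → m ℤ.≤ w a)

module Submission where

-- Write occ(v) for the number of times v occurs among the cut-vertices of T and mem(v) for
-- the number of blocks containing v.  Double counting gives
--   w(f_*) = Σ_v (occ(v) + mem(v) − occ(v)·mem(v)) · f(v),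
-- whose coefficient is 1 as soon as occ(v) = 1 or mem(v) = 1.  A cut-vertex occurs once; a
-- non-cut-vertex v lies in exactly one block, its closed neighbourhood N[v], because any two
-- neighbours a, b of v are adjacent: a ⊆-minimal set Q carrying an a–b walk that avoids v
-- forms together with v a nonseparable set, which lies in a block, and blocks are cliques.
-- So f ↦ f_* is a weight-preserving correspondence and the two minima agree.
-- The graph theory is classical and runs in the double-negation monad, which is left only
-- at decidable goals.  Minima exist because IIDFs take values ≤ 2, which makes "some IIDF
-- has weight ≤ k" decidable, and twice the indicator of a maximal independent set is an IIDF.

open import Defs

open import Algebra.Properties.CommutativeSemigroup using (interchange)
open import Data.Bool using (true; false; _∨_; if_then_else_)
open import Data.Empty using (⊥-elim)
open import Data.Fin using (Fin; zero; suc; toℕ; fromℕ<; _≟_)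
open import Data.Fin.Properties using (any?; all?; toℕ-fromℕ<)
open import Data.Fin.Subset using (Subset; inside; outside; _∈_; _∉_; _⊆_; _⊂_; _⊃_; _─_; _-_; _∪_; ⁅_⁆; ⊤; ⊥; Nonempty)
open import Data.Fin.Subset.Induction using (⊂-wellFounded; ⊃-wellFounded)
open import Data.Fin.Subset.Properties
  using (_∈?_; ∈⊤; ∉⊥; x∈p∪q⁻; x∈p∪q⁺; x∈⁅x⁆; x∈⁅y⁆⇒x≡y; ⊆-antisym; p─q⊆p; x∈p∧x≢y⇒x∈p-y)
open import Data.Integer as ℤ using (ℤ; +_; +≤+)
import Data.Integer.Properties as ℤP
open import Data.Integer.Tactic.RingSolver as ℤ-Solver using ()
import Data.List as List
open import Data.List using (List; []; _∷_; _++_; map; foldr; allFin; length; lookup)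
open import Data.List.Membership.Propositional using () renaming (_∈_ to _∈ˡ_)
open import Data.List.Membership.Propositional.Properties using (∈-allFin)
open import Data.List.Properties using (map-tabulate; tabulate-lookup; map-∘; map-cong)
open import Data.List.Relation.Unary.All using () renaming (lookup to lookupAll)
open import Data.List.Relation.Unary.AllPairs using (_∷_)
open import Data.List.Relation.Unary.Any using (here; there) renaming (any? to anyˡ?)
open import Data.List.Relation.Unary.Unique.Propositional using (Unique)
open import Data.List.Relation.Unary.Unique.Propositional.Properties using (allFin⁺)
open import Data.Nat using (ℕ; zero; suc; _+_; _*_; _≤_; _≤?_; z≤n; s≤s) renaming (_≟_ to _≟ℕ_)
open import Data.Nat.ListAction using (sum)
open import Data.Nat.Properties
  using (≤-refl; ≤-trans; ≤-antisym; ≰⇒>; m≤m+n; m≤n+m; +-identityʳ; *-identityˡ; +-comm; *-distribʳ-+; +-commutativeSemigroup)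
open import Data.Product using (Σ; ∃; _×_; _,_; proj₁; proj₂)
open import Data.Sum as Sum using (_⊎_; inj₁; inj₂)
open import Data.Vec using (_∷_; here; there; tabulate)
open import Data.Vec.Functional using (tail) renaming (_∷_ to _∷ᶠ_)
open import Data.Vec.Properties using ([]=⇒lookup; lookup⇒[]=; lookup∘tabulate)
open import Effect.Monad using (RawMonad)
open import Function using (id; _∘_; case_of_)
open import Function.Bundles using (Equivalence)
open import Induction.WellFounded using (Acc; acc)
open import Level using (0ℓ)
open import Relation.Binary.PropositionalEquality
open import Relation.Nullary using (Dec; yes; no; ¬_; does)
open import Relation.Nullary.Decidable using (decidable-stable; ¬¬-excluded-middle; map′; _×-dec_; _⊎-dec_; _→-dec_)
open import Relation.Nullary.Negation using (¬¬-Monad)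
open import Relation.Unary using (Decidable)

open RawMonad (¬¬-Monad {0ℓ})

¬¬-pull-→ : {A B : Set} → (A → ¬ ¬ B) → ¬ ¬ (A → B)
¬¬-pull-→ f ¬[a→b] = ¬[a→b] (λ a → ⊥-elim (f a (λ b → ¬[a→b] (λ _ → b))))

¬¬-pull-Fin : ∀ {n} {P : Fin n → Set} → (∀ i → ¬ ¬ P i) → ¬ ¬ (∀ i → P i)
¬¬-pull-Fin {zero}  f = return (λ ())
¬¬-pull-Fin {suc n} f = do
  p₀ ← f zero
  ps ← ¬¬-pull-Fin (f ∘ suc)
  return λ where zero → p₀ ; (suc i) → ps i

¬¬-decidable-Fin : ∀ {n} (P : Fin n → Set) → ¬ ¬ Decidable P
¬¬-decidable-Fin P = ¬¬-pull-Fin (λ _ → ¬¬-excluded-middle)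

module _ {n : ℕ} (P : Subset n → Set) where

  Maximal : Subset n → Set
  Maximal M = P M × (∀ M′ → M ⊆ M′ → P M′ → M′ ⊆ M)

  Minimal : Subset n → Set
  Minimal M = P M × (∀ M′ → M′ ⊆ M → P M′ → M ⊆ M′)

  ¬¬-maximal-⊇ : ∀ S → P S → ¬ ¬ ∃ λ M → S ⊆ M × Maximal M
  ¬¬-maximal-⊇ S = go S (⊃-wellFounded S)
    where
    go : ∀ S → Acc _⊃_ S → P S → ¬ ¬ ∃ λ M → S ⊆ M × Maximal M
    go S (acc larger) pS = ¬¬-excluded-middle {A = ∃ λ M′ → S ⊂ M′ × P M′} >>= λ where
      (yes (M′ , S⊂M′ , pM′)) → do
        (M , M′⊆M , max) ← go M′ (larger S⊂M′) pM′
        return (M , (λ {_} x∈S → M′⊆M (proj₁ S⊂M′ x∈S)) , max)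
      (no none) → return (S , (λ {_} x∈S → x∈S) , pS , λ M′ S⊆M′ pM′ {x} x∈M′ →
        decidable-stable (x ∈? S) (λ x∉S → none (M′ , ((λ {y} → S⊆M′ {y}) , x , x∈M′ , x∉S) , pM′)))

  ¬¬-minimal-⊆ : ∀ S → P S → ¬ ¬ ∃ λ M → M ⊆ S × Minimal M
  ¬¬-minimal-⊆ S = go S (⊂-wellFounded S)
    where
    go : ∀ S → Acc _⊂_ S → P S → ¬ ¬ ∃ λ M → M ⊆ S × Minimal M
    go S (acc smaller) pS = ¬¬-excluded-middle {A = ∃ λ M′ → M′ ⊂ S × P M′} >>= λ where
      (yes (M′ , M′⊂S , pM′)) → do
        (M , M⊆M′ , min) ← go M′ (smaller M′⊂S) pM′
        return (M , (λ {_} x∈M → proj₁ M′⊂S (M⊆M′ x∈M)) , min)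
      (no none) → return (S , (λ {_} x∈S → x∈S) , pS , λ M′ M′⊆S pM′ {x} x∈S →
        decidable-stable (x ∈? M′) (λ x∉M′ → none (M′ , ((λ {y} → M′⊆S {y}) , x , x∈S , x∉M′) , pM′)))

∃-bounded? : ∀ {n} (b : ℕ) {P : (Fin n → ℕ) → Set} → (∀ {f g} → f ≗ g → P f → P g) →
  (∀ {f} → P f → ∀ i → f i ≤ b) → Decidable P → Dec (∃ P)
∃-bounded? {zero} b resp bounded P? =
  map′ (λ p → _ , p) (λ (f , p) → resp (λ ()) p) (P? λ ())
∃-bounded? {suc n} b {P} resp bounded P? =
  map′ (λ (_ , h , p) → _ , p) from
    (any? λ c → ∃-bounded? b (resp ∘ ∷ᶠ-cong (toℕ c)) (λ p → bounded p ∘ suc) (P? ∘ (toℕ c ∷ᶠ_)))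
  where
  ∷ᶠ-cong : ∀ c {g h : Fin n → ℕ} → g ≗ h → (c ∷ᶠ g) ≗ (c ∷ᶠ h)
  ∷ᶠ-cong c g≗h zero    = refl
  ∷ᶠ-cong c g≗h (suc i) = g≗h i

  from : ∃ P → ∃ λ (c : Fin (suc b)) → ∃ λ h → P (toℕ c ∷ᶠ h)
  from (f , p) = fromℕ< (s≤s (bounded p zero)) , tail f , resp head-tail p
    where
    head-tail : f ≗ (toℕ (fromℕ< (s≤s (bounded p zero))) ∷ᶠ tail f)
    head-tail zero    = sym (toℕ-fromℕ< _)
    head-tail (suc i) = refl

least-ℕ : {Q : ℕ → Set} → Decidable Q → (∀ {j k} → j ≤ k → Q j → Q k) →
  ∀ {k} → Q k → ∃ λ m → Q m × ∀ {j} → Q j → m ≤ j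
least-ℕ Q? mono {zero}  q₀ = 0 , q₀ , λ _ → z≤n
least-ℕ Q? mono {suc k} qₖ₊₁ with Q? k
... | yes qₖ = least-ℕ Q? mono qₖ
... | no ¬qₖ = suc k , qₖ₊₁ , λ qⱼ → ≰⇒> (λ j≤k → ¬qₖ (mono j≤k qⱼ))

sumMap : {A : Set} → (A → ℕ) → List A → ℕ
sumMap h xs = sum (map h xs)

𝟙 : {P : Set} → Dec P → ℕ
𝟙 p = if does p then 1 else 0

module _ {A : Set} where

  sumMap-cong : ∀ {g h : A → ℕ} → g ≗ h → ∀ xs → sumMap g xs ≡ sumMap h xs
  sumMap-cong g≗h []       = refl
  sumMap-cong g≗h (x ∷ xs) = cong₂ _+_ (g≗h x) (sumMap-cong g≗h xs)

  sumMap-+ : ∀ (g h : A → ℕ) xs → sumMap (λ x → g x + h x) xs ≡ sumMap g xs + sumMap h xs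
  sumMap-+ g h []       = refl
  sumMap-+ g h (x ∷ xs) = trans (cong (λ s → g x + h x + s) (sumMap-+ g h xs))
                                (interchange +-commutativeSemigroup (g x) (h x) (sumMap g xs) (sumMap h xs))

  sumMap-*ʳ : ∀ (h : A → ℕ) c xs → sumMap (λ x → h x * c) xs ≡ sumMap h xs * c
  sumMap-*ʳ h c []       = refl
  sumMap-*ʳ h c (x ∷ xs) = trans (cong (λ s → h x * c + s) (sumMap-*ʳ h c xs)) (sym (*-distribʳ-+ c (h x) _))

  sumMap-0 : ∀ xs → sumMap (λ (_ : A) → 0) xs ≡ 0
  sumMap-0 []       = refl
  sumMap-0 (_ ∷ xs) = sumMap-0 xs

sumMap-swap : {A B : Set} (g : A → B → ℕ) (xs : List A) (ys : List B) →
  sumMap (λ x → sumMap (g x) ys) xs ≡ sumMap (λ y → sumMap (λ x → g x y) xs) ys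
sumMap-swap g []       ys = sym (sumMap-0 ys)
sumMap-swap g (x ∷ xs) ys =
  trans (cong (λ s → sumMap (g x) ys + s) (sumMap-swap g xs ys)) (sym (sumMap-+ (g x) _ ys))

if-does≡𝟙* : {P : Set} (p : Dec P) (a : ℕ) → (if does p then a else 0) ≡ 𝟙 p * a
if-does≡𝟙* (yes _) a = sym (+-identityʳ a)
if-does≡𝟙* (no _)  a = refl

module _ {A : Set} {P : A → Set} (P? : Decidable P) where

  sumMap-𝟙-none : ∀ xs → (∀ y → y ∈ˡ xs → ¬ P y) → sumMap (𝟙 ∘ P?) xs ≡ 0
  sumMap-𝟙-none []       _   = refl
  sumMap-𝟙-none (y ∷ xs) ¬Ps with P? y
  ... | yes py = ⊥-elim (¬Ps y (here refl) py)
  ... | no  _  = sumMap-𝟙-none xs (λ z z∈xs → ¬Ps z (there z∈xs))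

  sumMap-𝟙-unique : ∀ {xs x} → Unique xs → x ∈ˡ xs → P x → (∀ y → y ∈ˡ xs → P y → y ≡ x) →
    sumMap (𝟙 ∘ P?) xs ≡ 1
  sumMap-𝟙-unique {y ∷ xs} (y∉xs ∷ _) (here refl) px only with P? y
  ... | yes _  = cong suc (sumMap-𝟙-none xs λ z z∈xs pz → lookupAll y∉xs z∈xs (sym (only z (there z∈xs) pz)))
  ... | no ¬py = ⊥-elim (¬py px)
  sumMap-𝟙-unique {y ∷ xs} (y∉xs ∷ u) (there x∈xs) px only with P? y
  ... | yes py = ⊥-elim (lookupAll y∉xs x∈xs (only y (here refl) py))
  ... | no  _  = sumMap-𝟙-unique u x∈xs px (λ z z∈xs → only z (there z∈xs))

module _ {n : ℕ} where

  occurrences : List (Fin n) → Fin n → ℕ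
  occurrences xs v = sumMap (λ x → 𝟙 (x ≟ v)) xs

  memberships : List (Subset n) → Fin n → ℕ
  memberships Bs v = sumMap (λ B → 𝟙 (v ∈? B)) Bs

  sumMap-𝟙≟-allFin : ∀ (c : Fin n) (h : Fin n → ℕ) → sumMap (λ v → 𝟙 (c ≟ v) * h v) (allFin n) ≡ h c
  sumMap-𝟙≟-allFin c h = begin
    sumMap (λ v → 𝟙 (c ≟ v) * h v) (allFin n)
      ≡⟨ sumMap-cong only-c (allFin n) ⟩
    sumMap (λ v → 𝟙 (c ≟ v) * h c) (allFin n)
      ≡⟨ sumMap-*ʳ (𝟙 ∘ (c ≟_)) (h c) (allFin n) ⟩
    sumMap (𝟙 ∘ (c ≟_)) (allFin n) * h c
      ≡⟨ cong (_* h c) (sumMap-𝟙-unique (c ≟_) (allFin⁺ n) (∈-allFin c) refl (λ _ _ → sym)) ⟩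
    1 * h c
      ≡⟨ +-identityʳ (h c) ⟩
    h c
      ∎
    where
    open ≡-Reasoning
    only-c : ∀ v → 𝟙 (c ≟ v) * h v ≡ 𝟙 (c ≟ v) * h c
    only-c v with c ≟ v
    ... | yes refl = refl
    ... | no  _    = refl

  sumMap-occurrences : ∀ (h : Fin n → ℕ) xs → sumMap h xs ≡ sumMap (λ v → occurrences xs v * h v) (allFin n)
  sumMap-occurrences h xs = begin
    sumMap h xs
      ≡⟨ sumMap-cong (λ x → sym (sumMap-𝟙≟-allFin x h)) xs ⟩
    sumMap (λ x → sumMap (λ v → 𝟙 (x ≟ v) * h v) (allFin n)) xs
      ≡⟨ sumMap-swap _ xs (allFin n) ⟩
    sumMap (λ v → sumMap (λ x → 𝟙 (x ≟ v) * h v) xs) (allFin n)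
      ≡⟨ sumMap-cong (λ v → sumMap-*ʳ _ (h v) xs) (allFin n) ⟩
    sumMap (λ v → occurrences xs v * h v) (allFin n)
      ∎
    where open ≡-Reasoning

  sumMap-memberships : ∀ (h : Fin n → ℕ) xs Bs →
    sumMap (λ B → sumMap (λ x → if does (x ∈? B) then h x else 0) xs) Bs
      ≡ sumMap (λ x → memberships Bs x * h x) xs
  sumMap-memberships h xs Bs = begin
    sumMap (λ B → sumMap (λ x → if does (x ∈? B) then h x else 0) xs) Bs
      ≡⟨ sumMap-cong (λ B → sumMap-cong (λ x → if-does≡𝟙* (x ∈? B) (h x)) xs) Bs ⟩
    sumMap (λ B → sumMap (λ x → 𝟙 (x ∈? B) * h x) xs) Bs
      ≡⟨ sumMap-swap _ Bs xs ⟩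
    sumMap (λ x → sumMap (λ B → 𝟙 (x ∈? B) * h x) Bs) xs
      ≡⟨ sumMap-cong (λ x → sumMap-*ʳ _ (h x) Bs) xs ⟩
    sumMap (λ x → memberships Bs x * h x) xs
      ∎
    where open ≡-Reasoning

*-+-*-once : ∀ a b x → a ≡ 1 ⊎ b ≡ 1 → a * x + b * x ≡ x + a * (b * x)
*-+-*-once .1 b x (inj₁ refl) = cong₂ _+_ (*-identityˡ x) (sym (*-identityˡ (b * x)))
*-+-*-once a .1 x (inj₂ refl) rewrite *-identityˡ x = +-comm (a * x) x

sumMapℤ : {A : Set} → (A → ℤ) → List A → ℤ
sumMapℤ g xs = foldr ℤ._+_ (+ 0) (map g xs)

module _ {A : Set} where

  sumMapℤ-++ : ∀ (g : A → ℤ) xs ys → sumMapℤ g (xs ++ ys) ≡ sumMapℤ g xs ℤ.+ sumMapℤ g ys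
  sumMapℤ-++ g []       ys = sym (ℤP.+-identityˡ _)
  sumMapℤ-++ g (x ∷ xs) ys = trans (cong (λ s → g x ℤ.+ s) (sumMapℤ-++ g xs ys)) (sym (ℤP.+-assoc (g x) _ _))

  sumMapℤ-pos : ∀ (h : A → ℕ) xs → sumMapℤ (λ x → + h x) xs ≡ + sumMap h xs
  sumMapℤ-pos h []       = refl
  sumMapℤ-pos h (x ∷ xs) = trans (cong (λ s → + h x ℤ.+ s) (sumMapℤ-pos h xs)) (sym (ℤP.pos-+ (h x) _))

  sumMapℤ-pos-minus : ∀ (g h : A → ℕ) xs → sumMapℤ (λ x → + g x ℤ.- + h x) xs ≡ + sumMap g xs ℤ.- + sumMap h xs
  sumMapℤ-pos-minus g h []       = refl
  sumMapℤ-pos-minus g h (x ∷ xs)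
    rewrite sumMapℤ-pos-minus g h xs | ℤP.pos-+ (g x) (sumMap g xs) | ℤP.pos-+ (h x) (sumMap h xs) =
    minus-interchange (+ g x) (+ h x) (+ sumMap g xs) (+ sumMap h xs)
    where
    minus-interchange : ∀ a b c d → (a ℤ.- b) ℤ.+ (c ℤ.- d) ≡ (a ℤ.+ c) ℤ.- (b ℤ.+ d)
    minus-interchange = ℤ-Solver.solve-∀

  sumMapℤ-map : ∀ {B : Set} (g : B → ℤ) (k : A → B) xs → sumMapℤ g (map k xs) ≡ sumMapℤ (g ∘ k) xs
  sumMapℤ-map g k xs = cong (foldr ℤ._+_ (+ 0)) (sym (map-∘ xs))

  sumMapℤ-lookup : ∀ (g : A → ℤ) xs → sumMapℤ (g ∘ lookup xs) (allFin (length xs)) ≡ sumMapℤ g xs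
  sumMapℤ-lookup g xs = cong (foldr ℤ._+_ (+ 0)) (begin
    map (g ∘ lookup xs) (allFin (length xs)) ≡⟨ map-tabulate id (g ∘ lookup xs) ⟩
    List.tabulate (g ∘ lookup xs)            ≡⟨ map-tabulate (lookup xs) g ⟨
    map g (List.tabulate (lookup xs))        ≡⟨ cong (map g) (tabulate-lookup xs) ⟩
    map g xs                                 ∎)
    where open ≡-Reasoning

pos-+-minus-pos : ∀ {a w t c} → a + w ≡ t + c → + a ℤ.+ (+ w ℤ.- + c) ≡ + t
pos-+-minus-pos {a} {w} {t} {c} a+w≡t+c = begin
  + a ℤ.+ (+ w ℤ.- + c)   ≡⟨ +-minus-assoc (+ a) (+ w) (+ c) ⟩
  (+ a ℤ.+ + w) ℤ.- + c   ≡⟨ cong (ℤ._- + c) (sym (ℤP.pos-+ a w)) ⟩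
  + (a + w) ℤ.- + c       ≡⟨ cong (λ s → + s ℤ.- + c) a+w≡t+c ⟩
  + (t + c) ℤ.- + c       ≡⟨ cong (ℤ._- + c) (ℤP.pos-+ t c) ⟩
  (+ t ℤ.+ + c) ℤ.- + c   ≡⟨ +-minus-cancel (+ t) (+ c) ⟩
  + t                     ∎
  where
  open ≡-Reasoning
  +-minus-assoc : ∀ x y z → x ℤ.+ (y ℤ.- z) ≡ (x ℤ.+ y) ℤ.- z
  +-minus-assoc = ℤ-Solver.solve-∀
  +-minus-cancel : ∀ x y → (x ℤ.+ y) ℤ.- y ≡ x
  +-minus-cancel = ℤ-Solver.solve-∀

sumMap-≥ : {A : Set} (h : A → ℕ) {x : A} {xs : List A} → x ∈ˡ xs → h x ≤ sumMap h xs
sumMap-≥ h {xs = y ∷ xs} (here refl)  = m≤m+n (h y) _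
sumMap-≥ h {xs = y ∷ xs} (there x∈xs) = ≤-trans (sumMap-≥ h x∈xs) (m≤n+m _ (h y))

x∈p─q⇒x∉q : ∀ {n} {x : Fin n} {p q : Subset n} → x ∈ p ─ q → x ∉ q
x∈p─q⇒x∉q {p = _ ∷ p} {outside ∷ q} here         ()
x∈p─q⇒x∉q {p = _ ∷ p} {outside ∷ q} (there x∈p─q) (there x∈q) = x∈p─q⇒x∉q x∈p─q x∈q
x∈p─q⇒x∉q {p = _ ∷ p} {inside  ∷ q} (there x∈p─q) (there x∈q) = x∈p─q⇒x∉q x∈p─q x∈q

x∈p-y⇒x∈p : ∀ {n} {x y : Fin n} {p : Subset n} → x ∈ p - y → x ∈ p
x∈p-y⇒x∈p {y = y} {p} = p─q⊆p p ⁅ y ⁆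

x∈p-y⇒x≢y : ∀ {n} {x y : Fin n} {p : Subset n} → x ∈ p - y → x ≢ y
x∈p-y⇒x≢y x∈p-x refl = x∈p─q⇒x∉q x∈p-x (x∈⁅x⁆ _)

module _ {n : ℕ} (G : Graph n) where
  open Graph G using (adj; irrefl)

  Adj-sym : ∀ {u v} → Adj G u v → Adj G v u
  Adj-sym {u} {v} = trans (Graph.sym G v u)

  Adj⇒≢ : ∀ {u v} → Adj G u v → u ≢ v
  Adj⇒≢ {u} uu refl with trans (sym uu) (irrefl u)
  ... | ()

  Adj? : ∀ u v → Dec (Adj G u v)
  Adj? u v = adj u v Data.Bool.≟ true

  module _ {S : Subset n} where

    walk-start : ∀ {u w} → Walk G S u w → u ∈ S
    walk-start (here u∈S)     = u∈S
    walk-start (step u∈S _ _) = u∈S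

    walk-end : ∀ {u w} → Walk G S u w → w ∈ S
    walk-end (here w∈S)   = w∈S
    walk-end (step _ _ W) = walk-end W

    _++ʷ_ : ∀ {u v w} → Walk G S u v → Walk G S v w → Walk G S u w
    here _       ++ʷ W′ = W′
    step u∈S a W ++ʷ W′ = step u∈S a (W ++ʷ W′)

    walk-snoc : ∀ {u v w} → Walk G S u v → Adj G v w → w ∈ S → Walk G S u w
    walk-snoc W a w∈S = W ++ʷ step (walk-end W) a (here w∈S)

    walk-reverse : ∀ {u w} → Walk G S u w → Walk G S w u
    walk-reverse (here u∈S)     = here u∈S
    walk-reverse (step u∈S a W) = walk-snoc (walk-reverse W) (Adj-sym a) u∈S

  walk-mono : ∀ {S S′ u w} → S ⊆ S′ → Walk G S u w → Walk G S′ u w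
  walk-mono S⊆S′ (here u∈S)     = here (S⊆S′ u∈S)
  walk-mono S⊆S′ (step u∈S a W) = step (S⊆S′ u∈S) a (walk-mono S⊆S′ W)

  Clique : Subset n → Set
  Clique S = ∀ u w → u ∈ S → w ∈ S → u ≢ w → Adj G u w

  clique-walk : ∀ {S u w} → Clique S → u ∈ S → w ∈ S → Walk G S u w
  clique-walk {u = u} {w} clique u∈S w∈S with u ≟ w
  ... | yes refl = here u∈S
  ... | no  u≢w  = step u∈S (clique u w u∈S w∈S u≢w) (here w∈S)

  clique⇒nonseparable : ∀ {S} → Nonempty S → Clique S → NonseparableSet G S
  clique⇒nonseparable nonempty clique =
    nonempty , (λ _ _ → clique-walk clique) ,
    λ x (_ , u , w , u∈S , w∈S , u≢x , w≢x , _ , u↛w) →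
      u↛w (clique-walk (λ p q p∈ q∈ → clique p q (x∈p-y⇒x∈p p∈) (x∈p-y⇒x∈p q∈))
                       (x∈p∧x≢y⇒x∈p-y u∈S u≢x) (x∈p∧x≢y⇒x∈p-y w∈S w≢x))

  Hub : Subset n → Fin n → Set
  Hub S h = ∀ {y} → y ∈ S → ¬ ¬ Walk G S h y

  hub⇒¬¬connected : ∀ {S h} → Hub S h → ¬ ¬ Connected G S
  hub⇒¬¬connected hub = ¬¬-pull-Fin λ u → ¬¬-pull-Fin λ w → ¬¬-pull-→ λ u∈S → ¬¬-pull-→ λ w∈S → do
    h↝u ← hub u∈S
    h↝w ← hub w∈S
    return (walk-reverse h↝u ++ʷ h↝w)

  hub⇒¬cutVertex : ∀ {S x} → (x ∈ S → ∃ (Hub (S - x))) → ¬ IsCutVertexOf G S x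
  hub⇒¬cutVertex hubs (x∈S , u , w , u∈S , w∈S , u≢x , w≢x , _ , u↛w) with hubs x∈S
  ... | h , hub = hub (x∈p∧x≢y⇒x∈p-y u∈S u≢x) λ h↝u → hub (x∈p∧x≢y⇒x∈p-y w∈S w≢x) λ h↝w →
    u↛w (walk-reverse h↝u ++ʷ h↝w)

  module _ {a b : Fin n} {Q : Subset n} (a↝b : Walk G Q a b)
           (critical : ∀ {y} → y ∈ Q → ¬ Walk G (Q - y) a b) where

    critical-reachable : ∀ {y} → y ∈ Q → ¬ ¬ Walk G Q a y
    critical-reachable {y} y∈Q a↛y = critical y∈Q (avoid (here (walk-start a↝b)) a↝b)
      where
      avoid : ∀ {u w} → Walk G Q a u → Walk G Q u w → Walk G (Q - y) u w
      avoid a↝u (here u∈Q)       = here (x∈p∧x≢y⇒x∈p-y u∈Q λ { refl → a↛y a↝u })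
      avoid a↝u (step u∈Q uu′ W) =
        step (x∈p∧x≢y⇒x∈p-y u∈Q λ { refl → a↛y a↝u }) uu′ (avoid (walk-snoc a↝u uu′ (walk-start W)) W)

    module _ {x z : Fin n} (x∈Q : x ∈ Q) (z∈Q : z ∈ Q) (z≢x : z ≢ x) where

      InComponent : Fin n → Set
      InComponent k = Walk G (Q - x) k z

      outside⇒≢z : ∀ {u} → ¬ InComponent u → u ≢ z
      outside⇒≢z u∉K refl = u∉K (here (x∈p∧x≢y⇒x∈p-y z∈Q z≢x))

      enter-through-x : ∀ {u u′} → u ∈ Q → ¬ InComponent u → Adj G u u′ → InComponent u′ → u ≡ x
      enter-through-x {u} u∈Q u∉K uu′ u′∈K with u ≟ x
      ... | yes u≡x = u≡x
      ... | no  u≢x = ⊥-elim (u∉K (step (x∈p∧x≢y⇒x∈p-y u∈Q u≢x) uu′ u′∈K))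

      -- The component of z in Q − x is entered and left only through x, so a walk to b
      -- from outside it can be cut short to avoid z.
      reroute : Decidable InComponent → ¬ InComponent b → ∀ {u} → Walk G Q u b →
        (¬ InComponent u → Walk G (Q - z) u b) × (InComponent u → Walk G (Q - z) x b)
      reroute K? b∉K (here b∈Q) =
        (λ b∉K′ → here (x∈p∧x≢y⇒x∈p-y b∈Q (outside⇒≢z b∉K′))) , λ b∈K → ⊥-elim (b∉K b∈K)
      reroute K? b∉K (step {v = u′} u∈Q uu′ W) with reroute K? b∉K W | K? u′
      ... | from-u′ , _ | no u′∉K =
        (λ u∉K → step (x∈p∧x≢y⇒x∈p-y u∈Q (outside⇒≢z u∉K)) uu′ (from-u′ u′∉K)) ,
        λ u∈K → subst (λ s → Walk G (Q - z) s b)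
                      (enter-through-x (walk-start W) u′∉K (Adj-sym uu′) u∈K) (from-u′ u′∉K)
      ... | _ , from-x | yes u′∈K =
        (λ u∉K → subst (λ s → Walk G (Q - z) s b) (sym (enter-through-x u∈Q u∉K uu′ u′∈K)) (from-x u′∈K)) ,
        λ _ → from-x u′∈K

    critical-split : ∀ {x z} → x ∈ Q → z ∈ Q → z ≢ x → ¬ ¬ (Walk G (Q - x) z a ⊎ Walk G (Q - x) z b)
    critical-split {x} {z} x∈Q z∈Q z≢x z↛a,b = ¬¬-decidable-Fin (InComponent x∈Q z∈Q z≢x) λ K? →
      critical z∈Q (proj₁ (reroute x∈Q z∈Q z≢x K? (z↛a,b ∘ inj₂ ∘ walk-reverse) a↝b)
                          (z↛a,b ∘ inj₁ ∘ walk-reverse))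

  module _ {v a b : Fin n} {Q : Subset n} (a↝b : Walk G Q a b)
           (critical : ∀ {y} → y ∈ Q → ¬ Walk G (Q - y) a b)
           (v∉Q : v ∉ Q) (va : Adj G v a) (vb : Adj G v b) where

    private
      S : Subset n
      S = Q ∪ ⁅ v ⁆

      Q⊆S : Q ⊆ S
      Q⊆S y∈Q = x∈p∪q⁺ (inj₁ y∈Q)

      v∈S : v ∈ S
      v∈S = x∈p∪q⁺ (inj₂ (x∈⁅x⁆ v))

    apex-hub : Hub (Q ∪ ⁅ v ⁆) v
    apex-hub y∈S with x∈p∪q⁻ Q ⁅ v ⁆ y∈S
    ... | inj₁ y∈Q = do
      a↝y ← critical-reachable a↝b critical y∈Q
      return (step v∈S va (walk-mono Q⊆S a↝y))
    ... | inj₂ y∈⁅v⁆ rewrite x∈⁅y⁆⇒x≡y v y∈⁅v⁆ = return (here v∈S)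

    hub-after-removal : ∀ {x} → x ∈ Q ∪ ⁅ v ⁆ → ∃ (Hub ((Q ∪ ⁅ v ⁆) - x))
    hub-after-removal {x} x∈S with x∈p∪q⁻ Q ⁅ v ⁆ x∈S
    ... | inj₁ x∈Q = v , from-v
      where
      v∈S-x : v ∈ S - x
      v∈S-x = x∈p∧x≢y⇒x∈p-y v∈S λ { refl → v∉Q x∈Q }

      Q-x⊆S-x : Q - x ⊆ S - x
      Q-x⊆S-x y∈Q-x = x∈p∧x≢y⇒x∈p-y (Q⊆S (x∈p-y⇒x∈p y∈Q-x)) (x∈p-y⇒x≢y y∈Q-x)

      from-v : Hub (S - x) v
      from-v y∈S-x with x∈p∪q⁻ Q ⁅ v ⁆ (x∈p-y⇒x∈p y∈S-x)
      ... | inj₂ y∈⁅v⁆ rewrite x∈⁅y⁆⇒x≡y v y∈⁅v⁆ = return (here v∈S-x)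
      ... | inj₁ y∈Q = do
        y↝a∨b ← critical-split a↝b critical x∈Q y∈Q (x∈p-y⇒x≢y y∈S-x)
        return (walk-reverse (via y↝a∨b))
        where
        via : ∀ {y} → Walk G (Q - x) y a ⊎ Walk G (Q - x) y b → Walk G (S - x) y v
        via (inj₁ y↝a) = walk-snoc (walk-mono Q-x⊆S-x y↝a) (Adj-sym va) v∈S-x
        via (inj₂ y↝b) = walk-snoc (walk-mono Q-x⊆S-x y↝b) (Adj-sym vb) v∈S-x
    ... | inj₂ x∈⁅v⁆ rewrite x∈⁅y⁆⇒x≡y v x∈⁅v⁆ = a , from-a
      where
      Q⊆S-v : Q ⊆ S - v
      Q⊆S-v y∈Q = x∈p∧x≢y⇒x∈p-y (Q⊆S y∈Q) λ { refl → v∉Q y∈Q }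

      from-a : Hub (S - v) a
      from-a y∈S-v with x∈p∪q⁻ Q ⁅ v ⁆ (x∈p-y⇒x∈p y∈S-v)
      ... | inj₁ y∈Q    = do
        a↝y ← critical-reachable a↝b critical y∈Q
        return (walk-mono Q⊆S-v a↝y)
      ... | inj₂ y∈⁅v⁆ = ⊥-elim (x∈p-y⇒x≢y y∈S-v (x∈⁅y⁆⇒x≡y v y∈⁅v⁆))

    apex-nonseparable : ¬ ¬ NonseparableSet G (Q ∪ ⁅ v ⁆)
    apex-nonseparable = do
      connected ← hub⇒¬¬connected apex-hub
      return ((v , v∈S) , connected , λ _ → hub⇒¬cutVertex hub-after-removal)

  N[_] : Fin n → Subset n
  N[ v ] = tabulate λ u → does (u ≟ v) ∨ adj v u

  ⇒∈N[] : ∀ {v u} → u ≡ v ⊎ Adj G v u → u ∈ N[ v ]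
  ⇒∈N[] {v} {u} u∈N = lookup⇒[]= u N[ v ] (trans (lookup∘tabulate _ u) (true-if u∈N))
    where
    true-if : u ≡ v ⊎ Adj G v u → (does (u ≟ v) ∨ adj v u) ≡ true
    true-if (inj₁ u≡v) with u ≟ v
    ... | yes _   = refl
    ... | no  u≢v = ⊥-elim (u≢v u≡v)
    true-if (inj₂ vu) with does (u ≟ v)
    ... | true  = refl
    ... | false = vu

  ∈N[]⇒ : ∀ {v u} → u ∈ N[ v ] → u ≡ v ⊎ Adj G v u
  ∈N[]⇒ {v} {u} u∈N with u ≟ v | trans (sym (lookup∘tabulate _ u)) ([]=⇒lookup u∈N)
  ... | yes u≡v | _  = inj₁ u≡v
  ... | no  _   | vu = inj₂ vu

  v∈N[v] : ∀ {v} → v ∈ N[ v ]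
  v∈N[v] = ⇒∈N[] (inj₁ refl)

  module _ (blockGraph : IsBlockGraph G) where

    nonCut⇒neighbours-adjacent : ∀ {v a b} → ¬ IsCutVertex G v → Adj G v a → Adj G v b → a ≢ b → Adj G a b
    nonCut⇒neighbours-adjacent {v} {a} {b} ¬cut va vb a≢b = decidable-stable (Adj? a b) do
      a↝b ← walk-avoiding-v
      (Q , _ , minimal) ← ¬¬-minimal-⊆ Avoiding (⊤ - v) (a↝b , λ v∈⊤-v → x∈p-y⇒x≢y v∈⊤-v refl)
      let (a↝b′ , v∉Q) = proj₁ minimal
      nonseparable ← apex-nonseparable a↝b′ (critical minimal) v∉Q va vb
      (B , Q∪v⊆B , block) ← ¬¬-maximal-⊇ (NonseparableSet G) _ nonseparable
      return (proj₂ blockGraph B block a b (Q∪v⊆B (x∈p∪q⁺ (inj₁ (walk-start a↝b′))))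
                                             (Q∪v⊆B (x∈p∪q⁺ (inj₁ (walk-end a↝b′)))) a≢b)
      where
      Avoiding : Subset n → Set
      Avoiding Q = Walk G Q a b × v ∉ Q

      walk-avoiding-v : ¬ ¬ Walk G (⊤ - v) a b
      walk-avoiding-v a↛b =
        ¬cut (∈⊤ , a , b , ∈⊤ , ∈⊤ , Adj⇒≢ va ∘ sym , Adj⇒≢ vb ∘ sym , proj₁ blockGraph a b ∈⊤ ∈⊤ , a↛b)

      critical : ∀ {Q} → Minimal Avoiding Q → ∀ {y} → y ∈ Q → ¬ Walk G (Q - y) a b
      critical ((_ , v∉Q) , minimal) y∈Q a↝b =
        x∈p-y⇒x≢y (minimal _ x∈p-y⇒x∈p (a↝b , v∉Q ∘ x∈p-y⇒x∈p) y∈Q) refl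

    module _ {v : Fin n} (¬cut : ¬ IsCutVertex G v) where

      N[v]-clique : Clique N[ v ]
      N[v]-clique p q p∈N q∈N p≢q with ∈N[]⇒ p∈N | ∈N[]⇒ q∈N
      ... | inj₁ refl | inj₁ refl = ⊥-elim (p≢q refl)
      ... | inj₁ refl | inj₂ vq   = vq
      ... | inj₂ vp   | inj₁ refl = Adj-sym vp
      ... | inj₂ vp   | inj₂ vq   = nonCut⇒neighbours-adjacent ¬cut vp vq p≢q

      N[v]-nonseparable : NonseparableSet G N[ v ]
      N[v]-nonseparable = clique⇒nonseparable (v , v∈N[v]) N[v]-clique

      block∋v≡N[v] : ∀ {B} → IsBlock G B → v ∈ B → B ≡ N[ v ]
      block∋v≡N[v] {B} block v∈B = ⊆-antisym B⊆N[v] (proj₂ block N[ v ] B⊆N[v] N[v]-nonseparable)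
        where
        B⊆N[v] : B ⊆ N[ v ]
        B⊆N[v] {u} u∈B with u ≟ v
        ... | yes u≡v = ⇒∈N[] (inj₁ u≡v)
        ... | no  u≢v = ⇒∈N[] (inj₂ (proj₂ blockGraph B block v u v∈B u∈B (u≢v ∘ sym)))

      N[v]-block : ¬ ¬ IsBlock G N[ v ]
      N[v]-block = do
        (B , N[v]⊆B , block) ← ¬¬-maximal-⊇ (NonseparableSet G) N[ v ] N[v]-nonseparable
        return (subst (IsBlock G) (block∋v≡N[v] block (N[v]⊆B v∈N[v])) block)

weight≡sumMap : ∀ {n} (G : Graph n) f → weight G f ≡ sumMap f (allFin n)
weight≡sumMap {n} G f = sumMap-cong in-⊤ (allFin n)
  where
  in-⊤ : ∀ v → (if does (v ∈? ⊤) then f v else 0) ≡ f v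
  in-⊤ v with v ∈? ⊤
  ... | yes _  = refl
  ... | no v∉⊤ = ⊥-elim (v∉⊤ ∈⊤)

module _ {n : ℕ} {G : Graph n} (T : BlockCutpointGraph G) where
  open BlockCutpointGraph T

  CountedOnce : Fin n → Set
  CountedOnce v = occurrences cuts v ≡ 1 ⊎ memberships blocks v ≡ 1

  module _ (once : ∀ v → CountedOnce v) (f : Fin n → ℕ) where

    double-count : sumMap f cuts + sumMap (weightOn G f) blocks ≡ weight G f + sumMap (cutWeightIn f) blocks
    double-count = begin
      sumMap f cuts + sumMap (weightOn G f) blocks
        ≡⟨ cong₂ _+_ (sumMap-occurrences f cuts) (sumMap-memberships f (allFin n) blocks) ⟩
      sumMap (λ v → occ v * f v) (allFin n) + sumMap (λ v → mem v * f v) (allFin n)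
        ≡⟨ sumMap-+ _ _ (allFin n) ⟨
      sumMap (λ v → occ v * f v + mem v * f v) (allFin n)
        ≡⟨ sumMap-cong (λ v → *-+-*-once (occ v) (mem v) (f v) (once v)) (allFin n) ⟩
      sumMap (λ v → f v + occ v * (mem v * f v)) (allFin n)
        ≡⟨ sumMap-+ f _ (allFin n) ⟩
      sumMap f (allFin n) + sumMap (λ v → occ v * (mem v * f v)) (allFin n)
        ≡⟨ cong₂ _+_ (weight≡sumMap G f) (sumMap-occurrences (λ v → mem v * f v) cuts) ⟨
      weight G f + sumMap (λ c → mem c * f c) cuts
        ≡⟨ cong (_+_ (weight G f)) (sumMap-memberships f cuts blocks) ⟨
      weight G f + sumMap (cutWeightIn f) blocks
        ∎
      where
      open ≡-Reasoning
      occ = occurrences cuts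
      mem = memberships blocks

    weightT-induced : weightT (induced f) ≡ + weight G f
    weightT-induced = begin
      weightT (induced f)
        ≡⟨ sumMapℤ-++ (induced f) (map inj₁ cutIndices) (map inj₂ blockIndices) ⟩
      sumMapℤ (induced f) (map inj₁ cutIndices) ℤ.+ sumMapℤ (induced f) (map inj₂ blockIndices)
        ≡⟨ cong₂ ℤ._+_ (sumMapℤ-map (induced f) inj₁ cutIndices) (sumMapℤ-map (induced f) inj₂ blockIndices) ⟩
      sumMapℤ (induced f ∘ inj₁) cutIndices ℤ.+ sumMapℤ (induced f ∘ inj₂) blockIndices
        ≡⟨ cong₂ ℤ._+_ (sumMapℤ-lookup (λ c → + f c) cuts)
                       (sumMapℤ-lookup (λ B → + weightOn G f B ℤ.- + cutWeightIn f B) blocks) ⟩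
      sumMapℤ (λ c → + f c) cuts ℤ.+ sumMapℤ (λ B → + weightOn G f B ℤ.- + cutWeightIn f B) blocks
        ≡⟨ cong₂ ℤ._+_ (sumMapℤ-pos f cuts) (sumMapℤ-pos-minus (weightOn G f) (cutWeightIn f) blocks) ⟩
      + sumMap f cuts ℤ.+ (+ sumMap (weightOn G f) blocks ℤ.- + sumMap (cutWeightIn f) blocks)
        ≡⟨ pos-+-minus-pos double-count ⟩
      + weight G f
        ∎
      where
      open ≡-Reasoning
      cutIndices = allFin (length cuts)
      blockIndices = allFin (length blocks)

  weightT-cong : ∀ {g h} → g ≗ h → weightT g ≡ weightT h
  weightT-cong g≗h = cong (foldr ℤ._+_ (+ 0)) (map-cong g≗h allVertices)

module _ {n : ℕ} {G : Graph n} (blockGraph : IsBlockGraph G) (T : BlockCutpointGraph G) where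
  open BlockCutpointGraph T

  blockGraph⇒countedOnce : ∀ v → CountedOnce T v
  blockGraph⇒countedOnce v with anyˡ? (v ≟_) cuts
  ... | yes v∈cuts = inj₁ (sumMap-𝟙-unique (_≟ v) cuts-unique v∈cuts refl (λ _ _ → id))
  ... | no  v∉cuts = inj₂ (decidable-stable (memberships blocks v ≟ℕ 1) do
      N[v]-isBlock ← N[v]-block G blockGraph ¬cut
      return (sumMap-𝟙-unique (v ∈?_) blocks-unique (Equivalence.from (blocks-spec _) N[v]-isBlock) (v∈N[v] G)
                λ B B∈blocks v∈B → block∋v≡N[v] G blockGraph ¬cut (Equivalence.to (blocks-spec B) B∈blocks) v∈B))
    where
    ¬cut : ¬ IsCutVertex G v
    ¬cut = v∉cuts ∘ Equivalence.from (cuts-spec v)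

module _ {n : ℕ} (G : Graph n) where
  open Graph G using (adj)

  nbrSum-cong : ∀ {f g} → f ≗ g → ∀ v → nbrSum G f v ≡ nbrSum G g v
  nbrSum-cong {f} {g} f≗g v = sumMap-cong on-nbrs (allFin n)
    where
    on-nbrs : ∀ u → (if adj v u then f u else 0) ≡ (if adj v u then g u else 0)
    on-nbrs u with adj v u
    ... | true  = f≗g u
    ... | false = refl

  nbrSum-≥ : ∀ f {v u} → Adj G v u → f u ≤ nbrSum G f v
  nbrSum-≥ f {v} {u} vu = subst (_≤ nbrSum G f v) (on-nbr vu) (sumMap-≥ (λ u → if adj v u then f u else 0) (∈-allFin u))
    where
    on-nbr : adj v u ≡ true → (if adj v u then f u else 0) ≡ f u
    on-nbr eq rewrite eq = refl

  weight-cong : ∀ {f g} → f ≗ g → weight G f ≡ weight G g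
  weight-cong {f} {g} f≗g = trans (weight≡sumMap G f) (trans (sumMap-cong f≗g (allFin n)) (sym (weight≡sumMap G g)))

  IsIIDF? : Decidable (IsIIDF G)
  IsIIDF? f = all? (λ v → f v ≤? 2)
        ×-dec all? (λ v → (f v ≟ℕ 0) →-dec (2 ≤? nbrSum G f v))
        ×-dec all? (λ u → all? λ v → Adj? G u v →-dec ((f u ≟ℕ 0) ⊎-dec (f v ≟ℕ 0)))

  IsIIDF-resp : ∀ {f g} → f ≗ g → IsIIDF G f → IsIIDF G g
  IsIIDF-resp f≗g (bounded , dominating , independent) =
    (λ v → subst (_≤ 2) (f≗g v) (bounded v)) ,
    (λ v gv≡0 → subst (2 ≤_) (nbrSum-cong f≗g v) (dominating v (trans (f≗g v) gv≡0))) ,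
    (λ u v uv → Sum.map (trans (sym (f≗g u))) (trans (sym (f≗g v))) (independent u v uv))

  Independent : Subset n → Set
  Independent I = ∀ u w → u ∈ I → w ∈ I → ¬ Adj G u w

  twoOn : Subset n → Fin n → ℕ
  twoOn I v = if does (v ∈? I) then 2 else 0

  twoOn-maximal-IIDF : ∀ {I} → Maximal Independent I → IsIIDF G (twoOn I)
  twoOn-maximal-IIDF {I} (independent , maximal) = bounded , dominating , separated
    where
    bounded : ∀ v → twoOn I v ≤ 2
    bounded v with does (v ∈? I)
    ... | true  = ≤-refl
    ... | false = z≤n

    separated : ∀ u w → Adj G u w → twoOn I u ≡ 0 ⊎ twoOn I w ≡ 0
    separated u w uw with u ∈? I | w ∈? I
    ... | yes u∈I | yes w∈I = ⊥-elim (independent u w u∈I w∈I uw)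
    ... | no  _   | _       = inj₁ refl
    ... | yes _   | no  _   = inj₂ refl

    ¬¬-neighbour-in-I : ∀ {v} → v ∉ I → ¬ ¬ ∃ λ u → u ∈ I × Adj G v u
    ¬¬-neighbour-in-I {v} v∉I none =
      v∉I (maximal (I ∪ ⁅ v ⁆) (λ u∈I → x∈p∪q⁺ (inj₁ u∈I)) extended (x∈p∪q⁺ (inj₂ (x∈⁅x⁆ v))))
      where
      extended : Independent (I ∪ ⁅ v ⁆)
      extended p q p∈ q∈ pq with x∈p∪q⁻ I ⁅ v ⁆ p∈ | x∈p∪q⁻ I ⁅ v ⁆ q∈
      ... | inj₁ p∈I | inj₁ q∈I = independent p q p∈I q∈I pq
      ... | inj₂ p∈⁅v⁆ | inj₁ q∈I rewrite x∈⁅y⁆⇒x≡y v p∈⁅v⁆ = none (q , q∈I , pq)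
      ... | inj₁ p∈I | inj₂ q∈⁅v⁆ rewrite x∈⁅y⁆⇒x≡y v q∈⁅v⁆ = none (p , p∈I , Adj-sym G pq)
      ... | inj₂ p∈⁅v⁆ | inj₂ q∈⁅v⁆
        rewrite x∈⁅y⁆⇒x≡y v p∈⁅v⁆ | x∈⁅y⁆⇒x≡y v q∈⁅v⁆ = Adj⇒≢ G pq refl

    dominating : ∀ v → twoOn I v ≡ 0 → 2 ≤ nbrSum G (twoOn I) v
    dominating v twoOn≡0 = decidable-stable (2 ≤? nbrSum G (twoOn I) v) do
      (u , u∈I , vu) ← ¬¬-neighbour-in-I v∉I
      return (subst (_≤ nbrSum G (twoOn I) v) (two-in u∈I) (nbrSum-≥ (twoOn I) vu))
      where
      v∉I : v ∉ I
      v∉I v∈I with v ∈? I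
      ... | yes _    = case twoOn≡0 of λ ()
      ... | no  v∉I′ = v∉I′ v∈I
      two-in : ∀ {u} → u ∈ I → twoOn I u ≡ 2
      two-in {u} u∈I with u ∈? I
      ... | yes _  = refl
      ... | no u∉I = ⊥-elim (u∉I u∈I)

  minimum-IIDF : Σ ℕ (IsMinℕ (IsIIDF G) (weight G))
  minimum-IIDF = from-lightest lightest
    where
    WithinWeight : ℕ → Set
    WithinWeight k = ∃ λ f → IsIIDF G f × weight G f ≤ k

    WithinWeight? : Decidable WithinWeight
    WithinWeight? k = ∃-bounded? 2 (λ f≗g (iidf , w≤k) → IsIIDF-resp f≗g iidf , subst (_≤ k) (weight-cong f≗g) w≤k)
                                   (proj₁ ∘ proj₁) (λ f → IsIIDF? f ×-dec (weight G f ≤? k))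

    some-IIDF : ∃ (IsIIDF G)
    some-IIDF = decidable-stable (∃-bounded? 2 IsIIDF-resp proj₁ IsIIDF?) do
      (I , _ , maximal) ← ¬¬-maximal-⊇ Independent ⊥ (λ u _ u∈⊥ → ⊥-elim (∉⊥ u∈⊥))
      return (twoOn I , twoOn-maximal-IIDF maximal)

    lightest : ∃ λ m → WithinWeight m × ∀ {k} → WithinWeight k → m ≤ k
    lightest = least-ℕ WithinWeight? (λ j≤k (f , iidf , w≤j) → f , iidf , ≤-trans w≤j j≤k)
                       (proj₁ some-IIDF , proj₂ some-IIDF , ≤-refl)

    from-lightest : (∃ λ m → WithinWeight m × ∀ {k} → WithinWeight k → m ≤ k) → Σ ℕ (IsMinℕ (IsIIDF G) (weight G))
    from-lightest (m , (f , iidf , w≤m) , least) =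
      m , (f , iidf , ≤-antisym w≤m (least (f , iidf , ≤-refl))) , λ g iidf-g → least (g , iidf-g , ≤-refl)

IsMinℕ⇒IsMinℤ : ∀ {A B : Set} {P : A → Set} {Q : B → Set} {w : A → ℕ} {v : B → ℤ} {m} →
  (∀ {a} → P a → ∃ λ b → Q b × v b ≡ + w a) → (∀ {b} → Q b → ∃ λ a → P a × v b ≡ + w a) →
  IsMinℕ P w m → IsMinℤ Q v (+ m)
IsMinℕ⇒IsMinℤ {m = m} forth back ((a , pa , wa≡m) , least) =
  (let (b , qb , vb≡wa) = forth pa in b , qb , trans vb≡wa (cong +_ wa≡m)) ,
  λ b qb → let (a′ , pa′ , vb≡wa′) = back qb in subst (+ m ℤ.≤_) (sym vb≡wa′) (+≤+ (least a′ pa′))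

lemma2 : (n : ℕ) (G : Graph n) → IsBlockGraph G → (∃ λ v → IsCutVertex G v) →
    (T : BlockCutpointGraph G) →
    Σ ℕ λ m → IsMinℕ (IsIIDF G) (weight G) m
    × IsMinℤ (BlockCutpointGraph.IsIIIDF T) (BlockCutpointGraph.weightT T) (+ m)
lemma2 n G blockGraph _ T with minimum-IIDF G
... | m , isMin = m , isMin , IsMinℕ⇒IsMinℤ forth back isMin
  where
  open BlockCutpointGraph T

  weight-preserved : ∀ f → weightT (induced f) ≡ + weight G f
  weight-preserved = weightT-induced T (blockGraph⇒countedOnce blockGraph T)

  forth : ∀ {f} → IsIIDF G f → ∃ λ g → IsIIIDF g × weightT g ≡ + weight G f
  forth {f} iidf = induced f , (f , iidf , λ _ → refl) , weight-preserved f

  back : ∀ {g} → IsIIIDF g → ∃ λ f → IsIIDF G f × weightT g ≡ + weight G f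
  back (f , iidf , g≗f*) = f , iidf , trans (weightT-cong T g≗f*) (weight-preserved f)
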